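{- For every 2-permutation $w=w_1\cdots w_{2n}\in\mathfrak{S}_{\mathcal{N}}$, the number of piles resulting from playing Two-color Patience Sorting on $w$ under any strategy is at least the length of the longest weakly increasing subsequence of the word $w^{\pm}=w_1^{\pm}\cdots w_{2n}^{\pm}$.
   Context: $\mathcal{N}=\{1,\dots,n\}\cup\{\bar1,\dots,\bar n\}$; a 2-permutation is a word using each element of $\mathcal{N}$ exactly once. For $x\in\mathcal{N}$, $x^{\pm}$ is its numeric value ignoring the bar; $\mathrm{bar}(x,y)=1$ if exactly one of $x,y$ is barred, else $0$. Two-color Patience Sorting: $w_1$ forms a pile; for $i\ge2$, $w_i$ either forms a new pile or is played on a pile whose current top card $d$ satisfies $d^{\pm}>w_i^{\pm}$ and $\mathrm{bar}(w_i,d)=1$. A strategy is any rule for these choices. -}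

module Defs where

open import Data.Nat using (ℕ; suc; _≤_; _<_; _*_)
open import Data.Fin using (Fin; toℕ)
open import Data.Bool using (Bool; true; false; _≟_)
open import Data.Product using (_×_; _,_; proj₁; proj₂)
open import Data.List using (List; []; _∷_; _++_; [_]; length; map; filter)
open import Data.List.Relation.Binary.Sublist.Propositional using (_⊆_)
open import Data.List.Relation.Unary.Linked using (Linked)
open import Relation.Binary.PropositionalEquality using (_≡_; _≢_)
open import Relation.Binary.Definitions using (DecidableEquality)
open import Data.Product.Properties using (≡-dec)
import Data.Fin.Properties as FinP

-- An element of 𝒩 = {1..n} ∪ {1̄..n̄}: the numeric index (Fin n, value = toℕ i + 1)
-- together with a flag saying whether it is barred.
Card : ℕ → Set
Card n = Fin n × Bool

val : ∀ {n} → Card n → ℕ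
val (i , _) = suc (toℕ i)

barred : ∀ {n} → Card n → Bool
barred = proj₂

Bar : ∀ {n} → Card n → Card n → Set
Bar x y = barred x ≢ barred y

_≟C_ : ∀ {n} → DecidableEquality (Card n)
_≟C_ = ≡-dec FinP._≟_ _≟_

TwoPerm : (n : ℕ) → List (Card n) → Set
TwoPerm n w = (c : Card n) → length (filter (c ≟C_) w) ≡ 1

-- piles: each pile is a nonempty list whose head is the current top card
Piles : ℕ → Set
Piles n = List (List (Card n))

data PlayOn {n : ℕ} (c : Card n) : Piles n → Piles n → Set where
  here  : ∀ {d p ps} → val c < val d → Bar c d →
          PlayOn c ((d ∷ p) ∷ ps) ((c ∷ d ∷ p) ∷ ps)
  there : ∀ {p ps qs} → PlayOn c ps qs → PlayOn c (p ∷ ps) (p ∷ qs)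

data Step {n : ℕ} (c : Card n) : Piles n → Piles n → Set where
  newPile : ∀ {ps} → Step c ps (ps ++ [ c ∷ [] ])
  onPile  : ∀ {ps qs} → PlayOn c ps qs → Step c ps qs

-- Game ps w qs : starting from piles ps, dealing the word w (left to right)
-- under some sequence of legal choices (i.e. some strategy) yields piles qs
data Game {n : ℕ} : Piles n → List (Card n) → Piles n → Set where
  done : ∀ {ps} → Game ps [] ps
  move : ∀ {ps qs rs c w} → Step c ps qs → Game qs w rs → Game ps (c ∷ w) rs

pm : ∀ {n} → List (Card n) → List ℕ
pm = map val

WeakIncSubseq : List ℕ → List ℕ → Set
WeakIncSubseq s u = (s ⊆ u) × Linked _≤_ s

-- For a threshold m, count the piles whose top card has value at most m.
-- A move never lowers this count, since a card is only ever played on a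
-- strictly larger top.  Dealing a card c raises the count at threshold val c
-- by one: either c starts a new pile, or the pile it lands on had a top
-- above val c.  Hence along a weakly increasing subsequence v₁ ≤ ⋯ ≤ vₖ of
-- w^± the count at threshold vₖ is at least k, and it never exceeds the
-- number of piles.
module Submission where

open import Defs
open import Data.Nat using (ℕ; suc; _+_; _≤_; z≤n; s≤s)
open import Data.Nat.Properties
open import Data.Empty using (⊥)
open import Data.List using (List; []; _∷_; _++_; [_]; length; filter)
open import Data.List.Properties
  using (length-filter; filter-accept; filter-reject; filter-++; length-++)
open import Data.List.Relation.Binary.Pointwise as Pointwise using (Pointwise; _∷_)
open import Data.List.Relation.Binary.Sublist.Heterogeneous using (Sublist; []; _∷ʳ_; _∷_)
open import Data.List.Relation.Binary.Sublist.Heterogeneous.Properties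
  using (length-mono-≤; ⊆-filter-Sublist; fromPointwise; ++ʳ)
open import Data.List.Relation.Binary.Sublist.Propositional using (_⊆_; ⊆-refl)
open import Data.List.Relation.Unary.Linked using (Linked; [-]; _∷_)
open import Data.Product using (_,_)
open import Relation.Nullary using (yes; no)
open import Relation.Unary using (Decidable)
open import Relation.Binary.PropositionalEquality using (_≡_; refl; cong; module ≡-Reasoning)
open import Function using (_∘_)

module _ {n : ℕ} where

  TopAtMost : ℕ → List (Card n) → Set
  TopAtMost m []      = ⊥
  TopAtMost m (d ∷ _) = val d ≤ m

  topAtMost? : ∀ m → Decidable (TopAtMost m)
  topAtMost? m []      = no λ ()
  topAtMost? m (d ∷ _) = val d ≤? m

  topsAtMost : ℕ → Piles n → ℕ
  topsAtMost m ps = length (filter (topAtMost? m) ps)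

  TopLowered : List (Card n) → List (Card n) → Set
  TopLowered p q = ∀ m → TopAtMost m p → TopAtMost m q

  topLowered-refl : ∀ {p} → TopLowered p p
  topLowered-refl _ top = top

  topAtMost-mono : ∀ {m m′} p → m ≤ m′ → TopAtMost m p → TopAtMost m′ p
  topAtMost-mono (d ∷ _) m≤m′ d≤m = ≤-trans d≤m m≤m′

  topsAtMost-mono : ∀ {m m′} (ps : Piles n) → m ≤ m′ →
    topsAtMost m ps ≤ topsAtMost m′ ps
  topsAtMost-mono {m} {m′} ps m≤m′ =
    length-mono-≤ (⊆-filter-Sublist (topAtMost? m) (topAtMost? m′) raise (⊆-refl {x = ps}))
    where
    raise : ∀ {p q} → p ≡ q → TopAtMost m p → TopAtMost m′ q
    raise {p} refl = topAtMost-mono p m≤m′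

  playOn-pointwise : ∀ {c : Card n} {ps qs} → PlayOn c ps qs → Pointwise TopLowered ps qs
  playOn-pointwise (here c<d _) =
    (λ _ d≤m → ≤-trans (<⇒≤ c<d) d≤m) ∷ Pointwise.refl topLowered-refl
  playOn-pointwise (there play) = topLowered-refl ∷ playOn-pointwise play

  step-sublist : ∀ {c : Card n} {ps qs} → Step c ps qs → Sublist TopLowered ps qs
  step-sublist newPile       = ++ʳ _ (fromPointwise (Pointwise.refl topLowered-refl))
  step-sublist (onPile play) = fromPointwise (playOn-pointwise play)

  topsAtMost-step-mono : ∀ {c : Card n} {ps qs} m → Step c ps qs →
    topsAtMost m ps ≤ topsAtMost m qs
  topsAtMost-step-mono m step =
    length-mono-≤ (⊆-filter-Sublist P? P? (λ lowered → lowered m) (step-sublist step))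
    where P? = topAtMost? m

  topsAtMost-playOn : ∀ {c : Card n} {ps qs} → PlayOn c ps qs →
    topsAtMost (val c) qs ≡ suc (topsAtMost (val c) ps)
  topsAtMost-playOn {c} (here {d} {p} {ps} c<d _) = begin
    length (filter P? ((c ∷ d ∷ p) ∷ ps))   ≡⟨ cong length (filter-accept P? ≤-refl) ⟩
    suc (length (filter P? ps))             ≡⟨ cong (suc ∘ length) (filter-reject P? (<⇒≱ c<d)) ⟨
    suc (length (filter P? ((d ∷ p) ∷ ps))) ∎
    where
    open ≡-Reasoning
    P? = topAtMost? (val c)
  topsAtMost-playOn {c} (there {p} play) with topAtMost? (val c) p
  ... | yes _ = cong suc (topsAtMost-playOn play)
  ... | no _  = topsAtMost-playOn play

  topsAtMost-step : ∀ {c : Card n} {ps qs} → Step c ps qs →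
    topsAtMost (val c) qs ≡ suc (topsAtMost (val c) ps)
  topsAtMost-step {c} {ps} newPile = begin
    length (filter P? (ps ++ [ c ∷ [] ]))         ≡⟨ cong length (filter-++ P? ps _) ⟩
    length (filter P? ps ++ filter P? [ c ∷ [] ]) ≡⟨ cong (length ∘ (filter P? ps ++_)) (filter-accept P? ≤-refl) ⟩
    length (filter P? ps ++ [ c ∷ [] ])           ≡⟨ length-++ (filter P? ps) ⟩
    topsAtMost (val c) ps + 1                     ≡⟨ +-comm _ 1 ⟩
    suc (topsAtMost (val c) ps)                   ∎
    where
    open ≡-Reasoning
    P? = topAtMost? (val c)
  topsAtMost-step (onPile play) = topsAtMost-playOn play

  piles-bound : ∀ {ps : Piles n} {w final} → Game ps w final →
    ∀ {m s} → s ⊆ pm w → Linked _≤_ (m ∷ s) → topsAtMost m ps + length s ≤ length final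
  piles-bound {ps} done {m} [] _ = begin
    topsAtMost m ps + 0 ≡⟨ +-identityʳ _ ⟩
    topsAtMost m ps     ≤⟨ length-filter (topAtMost? m) ps ⟩
    length ps           ∎
    where open ≤-Reasoning
  piles-bound {ps} {final = final} (move {qs = qs} step game) {m} {s}
    (_ ∷ʳ s⊆w) increasing = begin
    topsAtMost m ps + length s ≤⟨ +-monoˡ-≤ (length s) (topsAtMost-step-mono m step) ⟩
    topsAtMost m qs + length s ≤⟨ piles-bound game s⊆w increasing ⟩
    length final               ∎
    where open ≤-Reasoning
  piles-bound {ps} {final = final} (move {qs = qs} {c = c} step game) {m} {_ ∷ s}
    (refl ∷ s⊆w) (m≤c ∷ increasing) = begin
    topsAtMost m ps + suc (length s)       ≡⟨ +-suc _ (length s) ⟩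
    suc (topsAtMost m ps) + length s       ≤⟨ +-monoˡ-≤ (length s) (s≤s (topsAtMost-mono ps m≤c)) ⟩
    suc (topsAtMost (val c) ps) + length s ≡⟨ cong (_+ length s) (topsAtMost-step step) ⟨
    topsAtMost (val c) qs + length s       ≤⟨ piles-bound game s⊆w increasing ⟩
    length final                           ∎
    where open ≤-Reasoning

mainTheorem15 : (n : ℕ) (w : List (Card n)) → TwoPerm n w →
    (final : Piles n) → Game [] w final →
    (s : List ℕ) → WeakIncSubseq s (pm w) → length s ≤ length final
mainTheorem15 n w _ final game s (s⊆w , increasing) = piles-bound game s⊆w (0≤head increasing)
  where
  0≤head : ∀ {s} → Linked _≤_ s → Linked _≤_ (0 ∷ s)
  0≤head {[]}    _          = [-]
  0≤head {_ ∷ _} increasing = z≤n ∷ increasing
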